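{- Let $n,G$ be positive natural numbers with $2^n$ dividing $G$, let $H=G/2^n$, and let $X=\{A\subseteq G: |A|=H\}$. For $\mathcal A\subseteq X$ define $\|\mathcal A\|_2=\min\{|x|: x\subseteq G \text{ and } x\not\subseteq a \text{ for all } a\in \mathcal A\}$. Let $k$ be a natural number and let $\mathcal A\subseteq X$ be non-empty with $\|\mathcal A\|_2\geq k+1$. Then \[\frac{|\mathcal A|}{|X|}\geq \frac{(G-H)!\,(H-k)!}{(G-k)!}.\]
   Context: Natural numbers are identified with the set of their predecessors: $G=\{0,1,\ldots,G-1\}$. -}

module Defs where

open import Data.Nat using (ℕ; zero; suc; _≤_)
open import Data.Nat.Properties using (_≟_)
open import Data.Bool using (true; false)
open import Data.Vec using (_∷_; [])
open import Data.List using (List; []; _∷_; _++_; map; filter; length)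
open import Data.Fin.Subset using (Subset; ∣_∣; _⊈_)
import Data.List.Membership.Propositional as L
open import Data.Product using (Σ; _×_)
open import Relation.Binary.PropositionalEquality using (_≡_)

allSubsets : (G : ℕ) → List (Subset G)
allSubsets zero = [] ∷ []
allSubsets (suc G) = map (true ∷_) (allSubsets G) ++ map (false ∷_) (allSubsets G)

X : (G H : ℕ) → List (Subset G)
X G H = filter (λ a → ∣ a ∣ ≟ H) (allSubsets G)

NotCovered : {G : ℕ} → List (Subset G) → Subset G → Set
NotCovered 𝒜 x = ∀ a → a L.∈ 𝒜 → x ⊈ a

IsNorm₂ : {G : ℕ} → List (Subset G) → ℕ → Set
IsNorm₂ {G} 𝒜 m =
  Σ (Subset G) (λ x → NotCovered 𝒜 x × ∣ x ∣ ≡ m)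
  × (∀ (x : Subset G) → NotCovered 𝒜 x → m ≤ ∣ x ∣)

-- Every H-subset covers exactly H C k of the k-subsets, and the hypothesis on ‖𝒜‖₂ says
-- that every k-subset of G lies in some member of 𝒜.  Double counting the incidences
-- therefore gives G C k ≤ |𝒜| · H C k, and dividing by G C H = |X| turns this into the
-- stated factorial bound, because G C H · (G-H)! · (H-k)! · H C k = G!/k! = G C k · (G-k)!.
-- Only H = G/2ⁿ enters, and 𝒜 may be counted with multiplicity.
module Submission where

open import Defs
open import Data.Nat using (ℕ; zero; suc; _*_; _∸_; _^_; _≤_; _≥_; _<_; _+_; NonZero; ≢-nonZero; ≢-nonZero⁻¹; _!; z≤n; s≤s)
open import Data.Nat.Properties
open import Data.Nat.Divisibility using (_∣_)
open import Data.Nat.DivMod using (m/n*n≡m)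
open import Data.Nat.Combinatorics using (_C_; nCk≡n!/k![n-k]!; k![n∸k]!∣n!; k>n⇒nCk≡0; nCk+nC[k+1]≡[n+1]C[k+1])
open import Data.Nat.ListAction using (sum)
open import Data.Nat.ListAction.Properties using (sum-++)
open import Data.Nat.Tactic.RingSolver using (solve-∀)
import Algebra.Properties.CommutativeSemigroup as CommSemigroupProperties
open CommSemigroupProperties +-commutativeSemigroup using () renaming (interchange to +-interchange)
open CommSemigroupProperties *-commutativeSemigroup using (xy∙z≈x∙zy; xy∙z≈zx∙y; xy∙z≈xz∙y)
open import Data.Bool using (if_then_else_; true; false)
open import Data.List using (List; []; _∷_; _++_; map; filter; length)
open import Data.List.Properties using (map-++; map-∘; filter-++; filter-none)
open import Data.List.Relation.Unary.All as All using (All; []; _∷_; universal)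
open import Data.List.Relation.Unary.All.Properties using (map⁺; all-filter)
open import Data.List.Relation.Unary.Any using (Any; here; there; any?)
open import Data.List.Relation.Unary.Unique.Propositional using (Unique)
open import Data.List.Membership.Propositional using (lose)
open import Data.Vec using ([]; _∷_)
open import Data.Fin.Subset using (Subset; ∣_∣; _⊆_; ⊤; inside; outside)
open import Data.Fin.Subset.Properties using (_⊆?_; ⊆⊤; ∣⊤∣≡n; ∣p∣≤n)
open import Data.Product using (Σ; _×_; _,_)
open import Data.Empty using (⊥-elim)
open import Function using (_∘_)
open import Relation.Nullary using (Dec; does; yes; no)
open import Relation.Nullary.Decidable using (dec-true)
open import Relation.Unary using (Pred; Decidable)
open import Relation.Binary.PropositionalEquality using (_≡_; _≢_; refl; sym; trans; cong; cong₂; module ≡-Reasoning)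

private
  variable
    A B : Set
    n h k : ℕ

∑ : List A → (A → ℕ) → ℕ
∑ xs f = sum (map f xs)

𝟙 : {P : Set} → Dec P → ℕ
𝟙 d = if does d then 1 else 0

∑-++ : ∀ xs ys (f : A → ℕ) → ∑ (xs ++ ys) f ≡ ∑ xs f + ∑ ys f
∑-++ xs ys f = trans (cong sum (map-++ f xs ys)) (sum-++ (map f xs) (map f ys))

∑-map : ∀ (g : A → B) xs (f : B → ℕ) → ∑ (map g xs) f ≡ ∑ xs (f ∘ g)
∑-map g xs f = cong sum (sym (map-∘ xs))

∑-zero : ∀ (xs : List A) → ∑ xs (λ _ → 0) ≡ 0
∑-zero []       = refl
∑-zero (_ ∷ xs) = ∑-zero xs

∑-+ : ∀ xs (f g : A → ℕ) → ∑ xs (λ x → f x + g x) ≡ ∑ xs f + ∑ xs g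
∑-+ []       f g = refl
∑-+ (x ∷ xs) f g = trans (cong (f x + g x +_) (∑-+ xs f g)) (+-interchange (f x) (g x) _ _)

∑-comm : ∀ xs ys (f : A → B → ℕ) → ∑ xs (λ x → ∑ ys (f x)) ≡ ∑ ys (λ y → ∑ xs (λ x → f x y))
∑-comm []       ys f = sym (∑-zero ys)
∑-comm (x ∷ xs) ys f =
  trans (cong (∑ ys (f x) +_) (∑-comm xs ys f)) (sym (∑-+ ys (f x) (λ y → ∑ xs (λ x′ → f x′ y))))

∑-const : ∀ {xs} {f : A → ℕ} {c} → All (λ x → f x ≡ c) xs → ∑ xs f ≡ length xs * c
∑-const []         = refl
∑-const (eq ∷ eqs) = cong₂ _+_ eq (∑-const eqs)

length≤∑ : ∀ {xs} {f : A → ℕ} → All (λ x → 1 ≤ f x) xs → length xs ≤ ∑ xs f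
length≤∑ []         = z≤n
length≤∑ (le ∷ les) = +-mono-≤ le (length≤∑ les)

1≤∑𝟙 : ∀ {P : Pred A _} (P? : Decidable P) {xs} → Any P xs → 1 ≤ ∑ xs (𝟙 ∘ P?)
1≤∑𝟙 P? {x ∷ _}  (here px)  rewrite dec-true (P? x) px = s≤s z≤n
1≤∑𝟙 P? {x ∷ xs} (there pxs) = ≤-trans (1≤∑𝟙 P? pxs) (m≤n+m _ (𝟙 (P? x)))

nCk*k![n∸k]!≡n! : k ≤ n → (n C k) * (k ! * (n ∸ k) !) ≡ n !
nCk*k![n∸k]!≡n! {k} {n} k≤n =
  trans (cong (_* (k ! * (n ∸ k) !)) (nCk≡n!/k![n-k]! k≤n))
        (m/n*n≡m {{k !* (n ∸ k) !≢0}} (k![n∸k]!∣n! k≤n))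

nCk≢0 : k ≤ n → n C k ≢ 0
nCk≢0 {k} {n} k≤n nCk≡0 = ≢-nonZero⁻¹ (n !) {{n !≢0}} (begin
  n !                         ≡⟨ nCk*k![n∸k]!≡n! k≤n ⟨
  (n C k) * (k ! * (n ∸ k) !) ≡⟨ cong (_* (k ! * (n ∸ k) !)) nCk≡0 ⟩
  0                           ∎)
  where open ≡-Reasoning

nCh*[n∸h]!*[h∸k]!*hCk≡nCk*[n∸k]! : k ≤ h → h ≤ n →
  (n C h) * (n ∸ h) ! * (h ∸ k) ! * (h C k) ≡ (n C k) * (n ∸ k) !
nCh*[n∸h]!*[h∸k]!*hCk≡nCk*[n∸k]! {k} {h} {n} k≤h h≤n =
  *-cancelʳ-≡ _ _ (k !) {{k !≢0}} (trans lhs≡n! (sym rhs≡n!))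
  where
  open ≡-Reasoning
  shuffle : ∀ a b c d e → a * b * c * d * e ≡ a * (d * (e * c) * b)
  shuffle = solve-∀
  lhs≡n! : (n C h) * (n ∸ h) ! * (h ∸ k) ! * (h C k) * k ! ≡ n !
  lhs≡n! = begin
    (n C h) * (n ∸ h) ! * (h ∸ k) ! * (h C k) * k !
      ≡⟨ shuffle (n C h) _ _ _ _ ⟩
    (n C h) * ((h C k) * (k ! * (h ∸ k) !) * (n ∸ h) !)
      ≡⟨ cong (λ z → (n C h) * (z * (n ∸ h) !)) (nCk*k![n∸k]!≡n! k≤h) ⟩
    (n C h) * (h ! * (n ∸ h) !)
      ≡⟨ nCk*k![n∸k]!≡n! h≤n ⟩
    n ! ∎
  rhs≡n! : (n C k) * (n ∸ k) ! * k ! ≡ n !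
  rhs≡n! = trans (xy∙z≈x∙zy (n C k) _ _) (nCk*k![n∸k]!≡n! (≤-trans k≤h h≤n))

nCk≤a*hCk⇒k≤h : ∀ a → k ≤ n → n C k ≤ a * (h C k) → k ≤ h
nCk≤a*hCk⇒k≤h {k} {n} {h} a k≤n le with k ≤? h
... | yes k≤h = k≤h
... | no  k≰h = ⊥-elim (nCk≢0 k≤n (n≤0⇒n≡0 (≤-trans le (≤-reflexive (begin
  a * (h C k) ≡⟨ cong (a *_) (k>n⇒nCk≡0 (≰⇒> k≰h)) ⟩
  a * 0       ≡⟨ *-zeroʳ a ⟩
  0           ∎)))))
  where open ≡-Reasoning

nCk≤a*hCk⇒[n∸h]!*[h∸k]!*nCh≤a*[n∸k]! : ∀ a → k ≤ h → h ≤ n →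
  n C k ≤ a * (h C k) → (n ∸ h) ! * (h ∸ k) ! * (n C h) ≤ a * (n ∸ k) !
nCk≤a*hCk⇒[n∸h]!*[h∸k]!*nCh≤a*[n∸k]! {k} {h} {n} a k≤h h≤n le =
  *-cancelʳ-≤ _ _ (h C k) {{≢-nonZero (nCk≢0 k≤h)}} (begin
    (n ∸ h) ! * (h ∸ k) ! * (n C h) * (h C k) ≡⟨ cong (_* (h C k)) (xy∙z≈zx∙y ((n ∸ h) !) _ _) ⟩
    (n C h) * (n ∸ h) ! * (h ∸ k) ! * (h C k) ≡⟨ nCh*[n∸h]!*[h∸k]!*hCk≡nCk*[n∸k]! k≤h h≤n ⟩
    (n C k) * (n ∸ k) !                       ≤⟨ *-monoˡ-≤ ((n ∸ k) !) le ⟩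
    a * (h C k) * (n ∸ k) !                   ≡⟨ xy∙z≈xz∙y a _ _ ⟩
    a * (n ∸ k) ! * (h C k)                   ∎)
  where open ≤-Reasoning

filter-map : ∀ {p q} {P : Pred B p} {Q : Pred A q} (P? : Decidable P) (Q? : Decidable Q) (f : A → B) →
  (∀ x → does (P? (f x)) ≡ does (Q? x)) → ∀ xs → filter P? (map f xs) ≡ map f (filter Q? xs)
filter-map P? Q? f same []       = refl
filter-map P? Q? f same (x ∷ xs) rewrite same x with does (Q? x)
... | true  = cong (f x ∷_) (filter-map P? Q? f same xs)
... | false = filter-map P? Q? f same xs

X-suc-zero : X (suc n) 0 ≡ map (outside ∷_) (X n 0)
X-suc-zero {n} = begin
  X (suc n) 0
    ≡⟨ filter-++ _ (map (inside ∷_) (allSubsets n)) _ ⟩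
  filter _ (map (inside ∷_) (allSubsets n)) ++ filter _ (map (outside ∷_) (allSubsets n))
    ≡⟨ cong₂ _++_ (filter-none _ (map⁺ (universal (λ _ ()) (allSubsets n))))
                  (filter-map _ _ (outside ∷_) (λ _ → refl) (allSubsets n)) ⟩
  map (outside ∷_) (X n 0) ∎
  where open ≡-Reasoning

X-suc-suc : X (suc n) (suc k) ≡ map (inside ∷_) (X n k) ++ map (outside ∷_) (X n (suc k))
X-suc-suc {n} {k} = trans (filter-++ _ (map (inside ∷_) (allSubsets n)) _)
  (cong₂ _++_ (filter-map _ _ (inside ∷_) (λ _ → refl) (allSubsets n))
              (filter-map _ _ (outside ∷_) (λ _ → refl) (allSubsets n)))

∑-X-suc-suc : ∀ (f : Subset (suc n) → ℕ) →
  ∑ (X (suc n) (suc k)) f ≡ ∑ (X n k) (f ∘ (inside ∷_)) + ∑ (X n (suc k)) (f ∘ (outside ∷_))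
∑-X-suc-suc {n} {k} f = begin
  ∑ (X (suc n) (suc k)) f
    ≡⟨ cong (λ xs → ∑ xs f) X-suc-suc ⟩
  ∑ (map (inside ∷_) (X n k) ++ map (outside ∷_) (X n (suc k))) f
    ≡⟨ ∑-++ (map (inside ∷_) (X n k)) _ f ⟩
  ∑ (map (inside ∷_) (X n k)) f + ∑ (map (outside ∷_) (X n (suc k))) f
    ≡⟨ cong₂ _+_ (∑-map (inside ∷_) (X n k) f) (∑-map (outside ∷_) (X n (suc k)) f) ⟩
  ∑ (X n k) (f ∘ (inside ∷_)) + ∑ (X n (suc k)) (f ∘ (outside ∷_)) ∎
  where open ≡-Reasoning

∑-X-⊆ : ∀ n (a : Subset n) k → ∑ (X n k) (λ x → 𝟙 (x ⊆? a)) ≡ ∣ a ∣ C k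
∑-X-⊆ zero    []            zero    = refl
∑-X-⊆ zero    []            (suc k) = refl
∑-X-⊆ (suc n) (c ∷ a)       zero    =
  trans (cong (λ xs → ∑ xs (λ x → 𝟙 (x ⊆? (c ∷ a)))) (X-suc-zero {n}))
        (trans (∑-map (outside ∷_) (X n 0) _) (∑-X-⊆ n a 0))
∑-X-⊆ (suc n) (inside ∷ a)  (suc k) =
  trans (∑-X-suc-suc {n} {k} _)
        (trans (cong₂ _+_ (∑-X-⊆ n a k) (∑-X-⊆ n a (suc k))) (nCk+nC[k+1]≡[n+1]C[k+1] ∣ a ∣ k))
∑-X-⊆ (suc n) (outside ∷ a) (suc k) =
  trans (∑-X-suc-suc {n} {k} _) (cong₂ _+_ (∑-zero (X n k)) (∑-X-⊆ n a (suc k)))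

length-X : ∀ n k → length (X n k) ≡ n C k
length-X n k = begin
  length (X n k)                ≡⟨ *-identityʳ _ ⟨
  length (X n k) * 1            ≡⟨ ∑-const {xs = X n k} (universal 𝟙[x⊆⊤]≡1 _) ⟨
  ∑ (X n k) (λ x → 𝟙 (x ⊆? ⊤)) ≡⟨ ∑-X-⊆ n ⊤ k ⟩
  ∣ ⊤ {n} ∣ C k                 ≡⟨ cong (_C k) (∣⊤∣≡n n) ⟩
  n C k                         ∎
  where
  open ≡-Reasoning
  𝟙[x⊆⊤]≡1 : ∀ x → 𝟙 (x ⊆? ⊤) ≡ 1
  𝟙[x⊆⊤]≡1 x = cong (if_then 1 else 0) (dec-true (x ⊆? ⊤) ⊆⊤)

nCk≤length*hCk : (𝒜 : List (Subset n)) → All (λ a → ∣ a ∣ ≡ h) 𝒜 →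
  (∀ x → ∣ x ∣ ≡ k → Any (x ⊆_) 𝒜) → n C k ≤ length 𝒜 * (h C k)
nCk≤length*hCk {n} {h} {k} 𝒜 sizes covered = begin
  n C k
    ≡⟨ length-X n k ⟨
  length (X n k)
    ≤⟨ length≤∑ (universal-X (λ x ∣x∣≡k → 1≤∑𝟙 (x ⊆?_) (covered x ∣x∣≡k))) ⟩
  ∑ (X n k) (λ x → ∑ 𝒜 (λ a → 𝟙 (x ⊆? a)))
    ≡⟨ ∑-comm (X n k) 𝒜 _ ⟩
  ∑ 𝒜 (λ a → ∑ (X n k) (λ x → 𝟙 (x ⊆? a)))
    ≡⟨ ∑-const (All.map (λ {a} ∣a∣≡h → trans (∑-X-⊆ n a k) (cong (_C k) ∣a∣≡h)) sizes) ⟩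
  length 𝒜 * (h C k) ∎
  where
  open ≤-Reasoning
  universal-X : ∀ {P : Subset n → Set} → (∀ x → ∣ x ∣ ≡ k → P x) → All P (X n k)
  universal-X p = All.map (λ {x} → p x) (all-filter _ (allSubsets n))

IsNorm₂⇒covered : ∀ {𝒜 : List (Subset n)} {m} → IsNorm₂ 𝒜 m → k < m → ∀ x → ∣ x ∣ ≡ k → Any (x ⊆_) 𝒜
IsNorm₂⇒covered {𝒜 = 𝒜} (_ , minimal) k<m x refl with any? (x ⊆?_) 𝒜
... | yes covered = covered
... | no  ¬covered = ⊥-elim (<⇒≱ k<m (minimal x (λ a a∈𝒜 x⊆a → ¬covered (lose a∈𝒜 x⊆a))))

nonempty⇒h≤n : ∀ {𝒜 : List (Subset n)} → 𝒜 ≢ [] → All (λ a → ∣ a ∣ ≡ h) 𝒜 → h ≤ n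
nonempty⇒h≤n {𝒜 = []}    ne _           = ⊥-elim (ne refl)
nonempty⇒h≤n {𝒜 = a ∷ _} _  (refl ∷ _) = ∣p∣≤n a

mainTheorem2 : (n G : ℕ) → .{{_ : NonZero n}} → .{{_ : NonZero G}} →
    (dv : 2 ^ n ∣ G) → (k : ℕ) →
    let H = _∣_.quotient dv in
    (𝒜 : List (Subset G)) → Unique 𝒜 → All (λ a → ∣ a ∣ ≡ H) 𝒜 → 𝒜 ≢ [] →
    Σ ℕ (λ m → IsNorm₂ 𝒜 m × suc k ≤ m) →
    length 𝒜 * (G ∸ k) ! ≥ (G ∸ H) ! * (H ∸ k) ! * length (X G H)
mainTheorem2 n G dv k 𝒜 _ sizes nonempty (m , norm@((x₀ , _ , ∣x₀∣≡m) , _) , k<m)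
  rewrite length-X G (_∣_.quotient dv) =
  nCk≤a*hCk⇒[n∸h]!*[h∸k]!*nCh≤a*[n∸k]! (length 𝒜) k≤H H≤G GCk≤|𝒜|*HCk
  where
  H : ℕ
  H = _∣_.quotient dv
  H≤G : H ≤ G
  H≤G = nonempty⇒h≤n nonempty sizes
  k≤G : k ≤ G
  k≤G = ≤-trans (<⇒≤ k<m) (≤-trans (≤-reflexive (sym ∣x₀∣≡m)) (∣p∣≤n x₀))
  GCk≤|𝒜|*HCk : G C k ≤ length 𝒜 * (H C k)
  GCk≤|𝒜|*HCk = nCk≤length*hCk 𝒜 sizes (IsNorm₂⇒covered norm k<m)
  k≤H : k ≤ H
  k≤H = nCk≤a*hCk⇒k≤h (length 𝒜) k≤G GCk≤|𝒜|*HCk
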